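{- Let $l$ and $n$ be positive integers. If $v_p(n+1)\geq\log_p(l+1)$ for every prime $p$ such that $p\leq l$ and $p\mid n+1$, then \[ C_l(n)=\frac{1}{(n+1)^l}\cdot\frac{((l+1)n)!}{(n!)^{l+1}} \] is an integer.
   Context: $v_p$ denotes the $p$-adic valuation. -}

module Defs where

open import Data.Nat using (ℕ; suc; _^_)
open import Data.Nat.Divisibility using (_∣_)
open import Data.Product using (_×_)
open import Relation.Nullary using (¬_)

IsValuation : ℕ → ℕ → ℕ → Set
IsValuation p m k = (p ^ k ∣ m) × ¬ (p ^ suc k ∣ m)

-- Put N = (l+1)n + l, so that N + 1 = (l+1)(n+1). Cancelling the common factor
-- (l+1)(n+1) l! (n!)^(l+1) in the multinomial divisibility (l+1)! ((n+1)!)^(l+1) ∣ ((l+1)(n+1))!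
-- yields (n+1)^l ∣ C(N,l) · ((l+1)n)! / (n!)^(l+1), so it suffices that no prime p ∣ n+1 divides
-- C(N,l). By (k+1) C(N,k+1) = C(N,k) (N-k) and (k+1) + (N-k) = N+1, the p-adic valuation of
-- C(N,k) stays 0 for k ≤ l as long as p^(v_p(k+1)+1) ∣ N+1 for all k < l; and the hypothesis
-- gives p^(v_p(k+1)) ≤ k+1 ≤ l < p^(v_p(n+1)).

module Submission where

open import Defs
open import Data.Nat
open import Data.Nat.Properties
open import Data.Nat.Divisibility
open import Data.Nat.DivMod using (m/n*n≡m)
open import Data.Nat.Combinatorics using (_C_; nCk≡n!/k![n-k]!; k![n∸k]!∣n!)
open import Data.Nat.Coprimality using (Coprime; coprime-divisor)
open import Data.Nat.Induction using (<-wellFounded)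
open import Data.Nat.Primality using (Prime; euclidsLemma; prime⇒nonZero; prime⇒nonTrivial)
open import Data.Nat.Primality.Factorisation using (factorise)
open import Data.Nat.Tactic.RingSolver using (solve-∀)
open import Data.List.Base using ([]; _∷_)
open import Data.List.Relation.Unary.All using ([]; _∷_)
open import Data.Product using (∃; ∃₂; _×_; _,_; proj₁; proj₂)
open import Data.Sum using ([_,_])
open import Function using (id; _∘_)
open import Induction.WellFounded using (Acc; acc)
open import Relation.Nullary using (¬_; yes; no; contradiction)
open import Relation.Binary.PropositionalEquality hiding ([_])

^-monoʳ-∣ : ∀ p {m n} → m ≤ n → p ^ m ∣ p ^ n
^-monoʳ-∣ p {m} {n} m≤n = divides (p ^ (n ∸ m)) (begin
  p ^ n               ≡⟨ cong (p ^_) (m+[n∸m]≡n m≤n) ⟨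
  p ^ (m + (n ∸ m))   ≡⟨ ^-distribˡ-+-* p m (n ∸ m) ⟩
  p ^ m * p ^ (n ∸ m) ≡⟨ *-comm (p ^ m) _ ⟩
  p ^ (n ∸ m) * p ^ m ∎)
  where open ≡-Reasoning

^-cancelʳ-< : ∀ p .{{_ : NonZero p}} {m n} → p ^ m < p ^ n → m < n
^-cancelʳ-< p pᵐ<pⁿ = ≰⇒> (<⇒≱ pᵐ<pⁿ ∘ ^-monoʳ-≤ p)

^-distribʳ-* : ∀ m n k → (m * n) ^ k ≡ m ^ k * n ^ k
^-distribʳ-* m n zero    = refl
^-distribʳ-* m n (suc k) = begin
  m * n * (m * n) ^ k       ≡⟨ cong (m * n *_) (^-distribʳ-* m n k) ⟩
  m * n * (m ^ k * n ^ k)   ≡⟨ rearrange m n (m ^ k) (n ^ k) ⟩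
  m * m ^ k * (n * n ^ k)   ∎
  where
  open ≡-Reasoning
  rearrange : ∀ a b x y → a * b * (x * y) ≡ a * x * (b * y)
  rearrange = solve-∀

prime∤1 : ∀ {p} → Prime p → ¬ p ∣ 1
prime∤1 prime-p p∣1 = >⇒≢ (nonTrivial⇒n>1 _ {{prime⇒nonTrivial prime-p}}) (∣1⇒≡1 p∣1)

prime∣m^n⇒prime∣m : ∀ {p} → Prime p → ∀ m n → p ∣ m ^ n → p ∣ m
prime∣m^n⇒prime∣m prime-p m zero    p∣1 = contradiction p∣1 (prime∤1 prime-p)
prime∣m^n⇒prime∣m prime-p m (suc n) p∣m^n = [ id , prime∣m^n⇒prime∣m prime-p m n ] (euclidsLemma m (m ^ n) prime-p p∣m^n)

coprime-if-noCommonPrimeDivisor : ∀ m n .{{_ : NonZero m}} → (∀ {p} → Prime p → p ∣ m → ¬ p ∣ n) → Coprime m n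
coprime-if-noCommonPrimeDivisor m n noCommon {d} (d∣m , d∣n) with factorise d {{nonZero-divisor}}
  where
  nonZero-divisor : NonZero d
  nonZero-divisor = ≢-nonZero λ { refl → ≢-nonZero⁻¹ m (0∣⇒≡0 d∣m) }
... | record { factors = [] ; isFactorisation = d≡1 } = d≡1
... | record { factors = p ∷ _ ; isFactorisation = d≡p*r ; factorsPrime = prime-p ∷ _ } =
  contradiction (∣-trans p∣d d∣n) (noCommon prime-p (∣-trans p∣d d∣m))
  where
  p∣d : p ∣ d
  p∣d = subst (p ∣_) (sym d≡p*r) (m∣m*n _)

nCk*[k!*[n∸k]!]≡n! : ∀ {n k} → k ≤ n → (n C k) * (k ! * (n ∸ k) !) ≡ n !
nCk*[k!*[n∸k]!]≡n! {n} {k} k≤n = begin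
  (n C k) * (k ! * (n ∸ k) !)                   ≡⟨ cong (_* (k ! * (n ∸ k) !)) (nCk≡n!/k![n-k]! k≤n) ⟩
  (n ! / (k ! * (n ∸ k) !)) * (k ! * (n ∸ k) !) ≡⟨ m/n*n≡m (k![n∸k]!∣n! k≤n) ⟩
  n !                                           ∎
  where
  open ≡-Reasoning
  instance _ = k !* (n ∸ k) !≢0

m!*n!∣[m+n]! : ∀ m n → m ! * n ! ∣ (m + n) !
m!*n!∣[m+n]! m n = subst (λ t → m ! * t ! ∣ (m + n) !) (m+n∸m≡n m n) (k![n∸k]!∣n! (m≤m+n m n))

nC[k+1]*[k+1]≡nCk*[n∸k] : ∀ {n k} → k < n → (n C suc k) * suc k ≡ (n C k) * (n ∸ k)
nC[k+1]*[k+1]≡nCk*[n∸k] {n} {k} k<n = *-cancelʳ-≡ _ _ (k ! * r !) {{k !* r !≢0}} (begin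
  (n C suc k) * suc k * (k ! * r !) ≡⟨ rearrange (n C suc k) (suc k) (k !) (r !) ⟩
  (n C suc k) * (suc k ! * r !)     ≡⟨ nCk*[k!*[n∸k]!]≡n! k<n ⟩
  n !                               ≡⟨ nCk*[k!*[n∸k]!]≡n! (<⇒≤ k<n) ⟨
  (n C k) * (k ! * (n ∸ k) !)       ≡⟨ cong (λ t → (n C k) * (k ! * t !)) n∸k≡1+r ⟩
  (n C k) * (k ! * (suc r * r !))   ≡⟨ rearrange′ (n C k) (k !) (suc r) (r !) ⟩
  (n C k) * suc r * (k ! * r !)     ≡⟨ cong (λ t → (n C k) * t * (k ! * r !)) n∸k≡1+r ⟨
  (n C k) * (n ∸ k) * (k ! * r !)   ∎)
  where
  open ≡-Reasoning
  r = n ∸ suc k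
  n∸k≡1+r : n ∸ k ≡ suc r
  n∸k≡1+r = +-∸-assoc 1 k<n
  rearrange : ∀ c a b d → c * a * (b * d) ≡ c * ((a * b) * d)
  rearrange = solve-∀
  rearrange′ : ∀ c b a d → c * (b * (a * d)) ≡ c * a * (b * d)
  rearrange′ = solve-∀

[n!]^j∣[j*n]! : ∀ n j → (n !) ^ j ∣ (j * n) !
[n!]^j∣[j*n]! n zero    = ∣-refl
[n!]^j∣[j*n]! n (suc j) = ∣-trans (*-monoʳ-∣ (n !) ([n!]^j∣[j*n]! n j)) (m!*n!∣[m+n]! n (j * n))

j!*[[1+n]!]^j∣[j*[1+n]]! : ∀ n j → j ! * (suc n !) ^ j ∣ (j * suc n) !
j!*[[1+n]!]^j∣[j*[1+n]]! n zero    = ∣-refl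
j!*[[1+n]!]^j∣[j*[1+n]]! n (suc j) = begin
  suc j ! * (suc n !) ^ suc j                   ≡⟨ rearrange (suc j) (suc n) (n !) (j !) ((suc n !) ^ j) ⟩
  suc j * suc n * (n ! * (j ! * (suc n !) ^ j)) ∣⟨ *-monoʳ-∣ (suc j * suc n) (*-monoʳ-∣ (n !) (j!*[[1+n]!]^j∣[j*[1+n]]! n j)) ⟩
  suc j * suc n * (n ! * (j * suc n) !)         ∣⟨ *-monoʳ-∣ (suc j * suc n) (m!*n!∣[m+n]! n (j * suc n)) ⟩
  (suc j * suc n) !                             ∎
  where
  open ∣-Reasoning
  rearrange : ∀ a s f g h → (a * g) * ((s * f) * h) ≡ (a * s) * (f * (g * h))
  rearrange = solve-∀

IsValuation-intro : ∀ {p m k b} .{{_ : NonZero p}} → m ≡ b * p ^ k → ¬ p ∣ b → IsValuation p m k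
IsValuation-intro {p} {m} {k} {b} m≡b*pᵏ p∤b = divides b m≡b*pᵏ , pᵏ⁺¹∤m
  where
  instance _ = m^n≢0 p k
  pᵏ⁺¹∤m : ¬ p ^ suc k ∣ m
  pᵏ⁺¹∤m (divides q m≡q*pᵏ⁺¹) = p∤b (divides q (*-cancelʳ-≡ b (q * p) (p ^ k) (begin
    b * p ^ k       ≡⟨ m≡b*pᵏ ⟨
    m               ≡⟨ m≡q*pᵏ⁺¹ ⟩
    q * (p * p ^ k) ≡⟨ *-assoc q p (p ^ k) ⟨
    q * p * p ^ k   ∎)))
    where open ≡-Reasoning

IsValuation-elim : ∀ {p m k} → IsValuation p m k → ∃ λ b → m ≡ b * p ^ k × ¬ p ∣ b
IsValuation-elim {p} {k = k} (divides b m≡b*pᵏ , pᵏ⁺¹∤m) =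
  b , m≡b*pᵏ , λ p∣b → pᵏ⁺¹∤m (subst (p ^ suc k ∣_) (sym m≡b*pᵏ) (*-monoˡ-∣ (p ^ k) p∣b))

valuation : ∀ {p} → Prime p → ∀ m .{{_ : NonZero m}} → ∃ (IsValuation p m)
valuation {p} prime-p m =
  let k , b , m≡b*pᵏ , p∤b = split m (<-wellFounded m) in k , IsValuation-intro {k = k} m≡b*pᵏ p∤b
  where
  instance _ = prime⇒nonZero prime-p
  q<q*p : ∀ q .{{_ : NonZero q}} → q < q * p
  q<q*p q = m<m*n q p (nonTrivial⇒n>1 p {{prime⇒nonTrivial prime-p}})
  split : ∀ m .{{_ : NonZero m}} → Acc _<_ m → ∃₂ λ k b → m ≡ b * p ^ k × ¬ p ∣ b
  split m (acc rec) with p ∣? m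
  ... | no  p∤m = 0 , m , sym (*-identityʳ m) , p∤m
  ... | yes (divides q refl) with split q {{m*n≢0⇒m≢0 q}} (rec (q<q*p q {{m*n≢0⇒m≢0 q}}))
  ...   | k , b , q≡b*pᵏ , p∤b = suc k , b , q*p≡b*pᵏ⁺¹ , p∤b
    where
    q*p≡b*pᵏ⁺¹ : q * p ≡ b * (p * p ^ k)
    q*p≡b*pᵏ⁺¹ = begin
      q * p           ≡⟨ cong (_* p) q≡b*pᵏ ⟩
      b * p ^ k * p   ≡⟨ *-assoc b (p ^ k) p ⟩
      b * (p ^ k * p) ≡⟨ cong (b *_) (*-comm (p ^ k) p) ⟩
      b * (p * p ^ k) ∎
      where open ≡-Reasoning

IsValuation-*ˡ : ∀ {p m k c} → Prime p → ¬ p ∣ c → IsValuation p m k → IsValuation p (c * m) k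
IsValuation-*ˡ {p} {m} {k} {c} prime-p p∤c v =
  let b , m≡b*pᵏ , p∤b = IsValuation-elim {k = k} v
  in IsValuation-intro {k = k} {{prime⇒nonZero prime-p}}
       (trans (cong (c *_) m≡b*pᵏ) (sym (*-assoc c b (p ^ k))))
       ([ p∤c , p∤b ] ∘ euclidsLemma c b prime-p)

IsValuation-+ : ∀ {p m n k} → IsValuation p m k → p ^ suc k ∣ m + n → IsValuation p n k
IsValuation-+ {p} {m} {n} {k} (pᵏ∣m , pᵏ⁺¹∤m) pᵏ⁺¹∣m+n =
  ∣m+n∣m⇒∣n (∣-trans (n∣m*n p) pᵏ⁺¹∣m+n) pᵏ∣m ,
  λ pᵏ⁺¹∣n → pᵏ⁺¹∤m (∣m+n∣m⇒∣n (subst (p ^ suc k ∣_) (+-comm m n) pᵏ⁺¹∣m+n) pᵏ⁺¹∣n)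

-- k+1 and n-k have the same valuation a because p^(a+1) divides their sum n+1.
prime∤nC[k+1] : ∀ {p n k a} → Prime p → k < n → IsValuation p (suc k) a → p ^ suc a ∣ suc n →
                ¬ p ∣ n C k → ¬ p ∣ n C suc k
prime∤nC[k+1] {p} {n} {k} {a} prime-p k<n v[1+k] pᵃ⁺¹∣1+n p∤nCk p∣nC[k+1] =
  proj₂ v[nCk*[n∸k]] (subst (p ^ suc a ∣_) (nC[k+1]*[k+1]≡nCk*[n∸k] k<n) (*-pres-∣ p∣nC[k+1] (proj₁ v[1+k])))
  where
  v[n∸k] : IsValuation p (n ∸ k) a
  v[n∸k] = IsValuation-+ {k = a} v[1+k] (subst (p ^ suc a ∣_) (sym (m+[n∸m]≡n (m≤n⇒m≤1+n k<n))) pᵃ⁺¹∣1+n)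
  v[nCk*[n∸k]] : IsValuation p ((n C k) * (n ∸ k)) a
  v[nCk*[n∸k]] = IsValuation-*ˡ {k = a} prime-p p∤nCk v[n∸k]

prime∤nCk : ∀ {p n k} → Prime p → k ≤ n →
            (∀ j a → j < k → IsValuation p (suc j) a → p ^ suc a ∣ suc n) → ¬ p ∣ n C k
prime∤nCk {k = zero}  prime-p _   _ = prime∤1 prime-p
prime∤nCk {k = suc k} prime-p k<n h =
  let a , v = valuation prime-p (suc k)
  in prime∤nC[k+1] {a = a} prime-p k<n v (h k a ≤-refl v) (prime∤nCk prime-p (<⇒≤ k<n) (λ j a → h j a ∘ m<n⇒m<1+n))

[1+l][1+n]≡1+[[1+l]n+l] : ∀ l n → suc l * suc n ≡ suc (suc l * n + l)
[1+l][1+n]≡1+[[1+l]n+l] = solve-∀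

[1+n]^l∣C*M : ∀ l n {M} → (suc l * n) ! ≡ M * (n !) ^ suc l → suc n ^ l ∣ ((suc l * n + l) C l) * M
[1+n]^l∣C*M l n {M} [1+l]n!≡M*F = *-cancelˡ-∣ K (begin
  K * S                       ≡⟨ K*S≡[1+l]!*[[1+n]!]^[1+l] ⟩
  suc l ! * (suc n !) ^ suc l ∣⟨ j!*[[1+n]!]^j∣[j*[1+n]]! n (suc l) ⟩
  (suc l * suc n) !           ≡⟨ K*[C*M]≡[1+l][1+n]! ⟨
  K * ((N C l) * M)           ∎)
  where
  open ∣-Reasoning
  N = suc l * n + l
  S = suc n ^ l
  F = (n !) ^ suc l
  K = suc l * suc n * (l ! * F)
  instance _ = m*n≢0 (suc l * suc n) (l ! * F) {{_}} {{m*n≢0 (l !) F {{l !≢0}} {{m^n≢0 (n !) (suc l) {{n !≢0}}}}}}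
  [1+l][1+n]≡1+N : suc l * suc n ≡ suc N
  [1+l][1+n]≡1+N = [1+l][1+n]≡1+[[1+l]n+l] l n
  K*S≡[1+l]!*[[1+n]!]^[1+l] : K * S ≡ suc l ! * (suc n !) ^ suc l
  K*S≡[1+l]!*[[1+n]!]^[1+l] = begin-equality
    K * S                             ≡⟨ rearrange (suc l) (suc n) (l !) F S ⟩
    (suc l * l !) * ((suc n * S) * F) ≡⟨ cong ((suc l * l !) *_) (^-distribʳ-* (suc n) (n !) (suc l)) ⟨
    suc l ! * (suc n !) ^ suc l       ∎
    where
    rearrange : ∀ a s b f t → a * s * (b * f) * t ≡ (a * b) * ((s * t) * f)
    rearrange = solve-∀
  K*[C*M]≡[1+l][1+n]! : K * ((N C l) * M) ≡ (suc l * suc n) !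
  K*[C*M]≡[1+l][1+n]! = begin-equality
    K * ((N C l) * M)                                 ≡⟨ rearrange (suc l * suc n) (l !) F (N C l) M ⟩
    suc l * suc n * ((N C l) * (l ! * (M * F)))       ≡⟨ cong (λ t → suc l * suc n * ((N C l) * (l ! * t))) [1+l]n!≡M*F ⟨
    suc l * suc n * ((N C l) * (l ! * (suc l * n) !)) ≡⟨ cong (λ t → suc l * suc n * ((N C l) * (l ! * t !))) (m+n∸n≡m (suc l * n) l) ⟨
    suc l * suc n * ((N C l) * (l ! * (N ∸ l) !))     ≡⟨ cong (suc l * suc n *_) (nCk*[k!*[n∸k]!]≡n! (m≤n+m l (suc l * n))) ⟩
    suc l * suc n * N !                               ≡⟨ cong (_* N !) [1+l][1+n]≡1+N ⟩
    suc N !                                           ≡⟨ cong _! [1+l][1+n]≡1+N ⟨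
    (suc l * suc n) !                                 ∎
    where
    rearrange : ∀ a b f c m → a * (b * f) * (c * m) ≡ a * (c * (b * (m * f)))
    rearrange = solve-∀

module _ {l n : ℕ} (hyp : ∀ p k → Prime p → p ≤ l → p ∣ suc n → IsValuation p (suc n) k → suc l ≤ p ^ k) where

  l<p^v[1+n] : ∀ {p k} → Prime p → p ∣ suc n → IsValuation p (suc n) k → l < p ^ k
  l<p^v[1+n] {p} {k} prime-p p∣1+n v with p ≤? l
  ... | yes p≤l = hyp p k prime-p p≤l p∣1+n v
  ... | no  p≰l = <-≤-trans (≰⇒> p≰l) (subst (_≤ p ^ k) (*-identityʳ p) (^-monoʳ-≤ p (n≢0⇒n>0 k≢0)))
    where
    instance _ = prime⇒nonZero prime-p
    k≢0 : k ≢ 0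
    k≢0 refl = proj₂ v (subst (_∣ suc n) (sym (*-identityʳ p)) p∣1+n)

  p^[1+v[1+j]]∣1+n : ∀ {p j} a → Prime p → p ∣ suc n → j < l → IsValuation p (suc j) a → p ^ suc a ∣ suc n
  p^[1+v[1+j]]∣1+n {p} a prime-p p∣1+n j<l v[1+j] =
    let k , v[1+n] = valuation prime-p (suc n)
        pᵃ<pᵏ = ≤-<-trans (≤-trans (∣⇒≤ (proj₁ v[1+j])) j<l) (l<p^v[1+n] {k = k} prime-p p∣1+n v[1+n])
    in ∣-trans (^-monoʳ-∣ p (^-cancelʳ-< p {{prime⇒nonZero prime-p}} {a} {k} pᵃ<pᵏ)) (proj₁ v[1+n])

  coprime-[1+n]^l-C : Coprime (suc n ^ l) ((suc l * n + l) C l)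
  coprime-[1+n]^l-C = coprime-if-noCommonPrimeDivisor (suc n ^ l) _ {{m^n≢0 (suc n) l}} λ prime-p p∣S →
    let p∣1+n = prime∣m^n⇒prime∣m prime-p (suc n) l p∣S
        1+n∣1+N = subst (suc n ∣_) ([1+l][1+n]≡1+[[1+l]n+l] l n) (n∣m*n (suc l))
    in prime∤nCk prime-p (m≤n+m l (suc l * n))
         λ j a j<l v → ∣-trans (p^[1+v[1+j]]∣1+n a prime-p p∣1+n j<l v) 1+n∣1+N

theorem8 : (l n : ℕ) → .{{NonZero l}} → .{{NonZero n}} →
    (∀ p k → Prime p → p ≤ l → p ∣ suc n → IsValuation p (suc n) k → suc l ≤ p ^ k) →
    (suc n ^ l) * ((n !) ^ suc l) ∣ ((suc l * n) !)
theorem8 l n hyp with [n!]^j∣[j*n]! n (suc l)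
... | divides M [1+l]n!≡M*F =
  subst (suc n ^ l * (n !) ^ suc l ∣_) (sym [1+l]n!≡M*F)
    (*-monoˡ-∣ ((n !) ^ suc l) (coprime-divisor (coprime-[1+n]^l-C hyp) ([1+n]^l∣C*M l n {M} [1+l]n!≡M*F)))
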